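{- Let $E$ be a principal ideal domain, let $f_1,f_2\in E[x]$ with $\gcd(f_1,f_2)=1$, let $R_i=E[x]/(f_i)$, suppose $R_{12}=E[x]/(f_1,f_2)$ is finite, and for $i=1,2$ let $(R_i,X,N_i)$ be an irredundant digit system. Let $R=E[x]/(f_1f_2)$ and $\psi:R\to R_1\times R_2$, $a\mapsto(a\bmod f_1,a\bmod f_2)$. The following are equivalent: (i) $(d_1,d_2)\in\psi(R)$ for all $d_1\in N_1$ and $d_2\in N_2$; (ii) there exists $\tilde d\in E[x]$ such that $d\equiv\tilde d\pmod{(f_1,f_2)}$ for all $d\in N_1\cup N_2$.
   Context: A digit system is a triple $(V,\phi,D)$ with $V$ an abelian group, $\phi$ an endomorphism with $V/\phi(V)$ finite, and $D\subseteq V$ finite meeting every coset of $\phi(V)$; it is irredundant if $D$ contains exactly one element of each coset. $X$ denotes multiplication by the residue class of $x$. $(f_1,f_2)$ is the ideal of $E[x]$ generated by $f_1,f_2$; an element of $R_i$ is congruent to $\tilde d$ modulo $(f_1,f_2)$ if their images in $E[x]/(f_1,f_2)$ agree. -}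

module Defs where

open import Level using (Level; _⊔_) renaming (suc to lsuc)
open import Algebra.Bundles using (CommutativeRing)
open import Data.Nat using (ℕ; zero; suc)
open import Data.Fin using (Fin)
open import Data.List using (List; []; _∷_; map)
open import Data.List.Membership.Propositional using (_∈_)
open import Data.Product using (Σ; ∃; _×_; _,_)
open import Data.Sum using (_⊎_)
open import Relation.Nullary using (¬_)
open import Relation.Unary using (Pred)
open import Function.Bundles using (_⇔_)

module _ {c ℓ : Level} (E : CommutativeRing c ℓ) where
  open CommutativeRing E

  _∣E_ : Carrier → Carrier → Set (c ⊔ ℓ)
  g ∣E a = ∃ λ q → a ≈ q * g

  record IsIntegralDomain : Set (c ⊔ ℓ) where
    field
      nontrivial   : ¬ (1# ≈ 0#)
      noZeroDivisors : ∀ a b → a * b ≈ 0# → (a ≈ 0#) ⊎ (b ≈ 0#)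

  record IsIdeal (I : Pred Carrier (c ⊔ ℓ)) : Set (c ⊔ ℓ) where
    field
      respects : ∀ {a b} → a ≈ b → I a → I b
      has-0    : I 0#
      +-closed : ∀ {a b} → I a → I b → I (a + b)
      *-closed : ∀ r {a} → I a → I (r * a)

  IsPrincipal : Pred Carrier (c ⊔ ℓ) → Set (c ⊔ ℓ)
  IsPrincipal I = ∃ λ g → ∀ a → (I a ⇔ (g ∣E a))

  record IsPID : Set (lsuc (c ⊔ ℓ)) where
    field
      integralDomain : IsIntegralDomain
      principal      : ∀ (I : Pred Carrier (c ⊔ ℓ)) → IsIdeal I → IsPrincipal I

  -- The polynomial ring E[x]: coefficient lists (constant term first)
  Poly : Set c
  Poly = List Carrier

  coeff : Poly → ℕ → Carrier
  coeff []      _       = 0#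
  coeff (a ∷ p) zero    = a
  coeff (a ∷ p) (suc n) = coeff p n

  -- equality in E[x]: all coefficients agree (trailing zeros ignored)
  _≈P_ : Poly → Poly → Set ℓ
  p ≈P q = ∀ n → coeff p n ≈ coeff q n

  _+P_ : Poly → Poly → Poly
  []      +P q       = q
  (a ∷ p) +P []      = a ∷ p
  (a ∷ p) +P (b ∷ q) = (a + b) ∷ (p +P q)

  _·P_ : Carrier → Poly → Poly
  a ·P p = map (a *_) p

  _*P_ : Poly → Poly → Poly
  []      *P q = []
  (a ∷ p) *P q = (a ·P q) +P (0# ∷ (p *P q))

  -P_ : Poly → Poly
  -P p = map -_ p

  _-P_ : Poly → Poly → Poly
  p -P q = p +P (-P q)

  oneP : Poly
  oneP = 1# ∷ []

  xP : Poly
  xP = 0# ∷ 1# ∷ []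

  _∣P_ : Poly → Poly → Set (c ⊔ ℓ)
  g ∣P p = ∃ λ q → p ≈P (q *P g)

  GcdOne : Poly → Poly → Set (c ⊔ ℓ)
  GcdOne f₁ f₂ = ∀ g → g ∣P f₁ → g ∣P f₂ → g ∣P oneP

  CongMod : Poly → Poly → Poly → Set (c ⊔ ℓ)
  CongMod f p q = f ∣P (p -P q)

  InIdeal₂ : Poly → Poly → Poly → Set (c ⊔ ℓ)
  InIdeal₂ f₁ f₂ p = ∃ λ a → ∃ λ b → p ≈P ((a *P f₁) +P (b *P f₂))

  CongMod₂ : Poly → Poly → Poly → Poly → Set (c ⊔ ℓ)
  CongMod₂ f₁ f₂ p q = InIdeal₂ f₁ f₂ (p -P q)

  FiniteQuot₂ : Poly → Poly → Set (c ⊔ ℓ)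
  FiniteQuot₂ f₁ f₂ =
    Σ ℕ λ n → Σ (Fin n → Poly) λ r → ∀ p → ∃ λ i → CongMod₂ f₁ f₂ p (r i)

  -- Digit systems (R_f, X, D) with R_f = E[x]/(f), X = mult. by x.
  -- Elements of R_f are represented by polynomials, equality CongMod f.
  -- u and v lie in the same coset of X(R_f)
  SameCoset : Poly → Poly → Poly → Set (c ⊔ ℓ)
  SameCoset f u v = ∃ λ w → CongMod f (u -P v) (xP *P w)

  record IsIrredundantDigitSystemX (f : Poly) (D : List Poly) : Set (c ⊔ ℓ) where
    field
      quotFinite  : Σ ℕ λ n → Σ (Fin n → Poly) λ r → ∀ v → ∃ λ i → SameCoset f v (r i)
      meetsCosets : ∀ v → ∃ λ d → d ∈ D × SameCoset f v d
      irredundant : ∀ d d′ → d ∈ D → d′ ∈ D → SameCoset f d d′ → CongMod f d d′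

  InImageψ : Poly → Poly → Poly → Poly → Set (c ⊔ ℓ)
  InImageψ f₁ f₂ d₁ d₂ = ∃ λ a → CongMod f₁ a d₁ × CongMod f₂ a d₂

  Cond-i : Poly → Poly → List Poly → List Poly → Set (c ⊔ ℓ)
  Cond-i f₁ f₂ N₁ N₂ = ∀ d₁ d₂ → d₁ ∈ N₁ → d₂ ∈ N₂ → InImageψ f₁ f₂ d₁ d₂

  Cond-ii : Poly → Poly → List Poly → List Poly → Set (c ⊔ ℓ)
  Cond-ii f₁ f₂ N₁ N₂ = ∃ λ d̃ →
    (∀ d → d ∈ N₁ → CongMod₂ f₁ f₂ d d̃) × (∀ d → d ∈ N₂ → CongMod₂ f₁ f₂ d d̃)

-- The image of ψ is exactly {(d₁ , d₂) | d₁ ≡ d₂ mod (f₁,f₂)}: if a reduces to d₁ and d₂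
-- then d₁ ≡ a ≡ d₂ mod (f₁,f₂); conversely, from d₁ - d₂ = A f₁ + B f₂ the element
-- a = d₁ - A f₁ reduces to d₁ mod f₁ and to d₂ mod f₂. Condition (i) therefore says that
-- congruence mod (f₁,f₂) relates every digit of N₁ to every digit of N₂, and since a digit
-- set meets every coset it is nonempty, so this happens precisely when all digits share a
-- single class, which is (ii).
module Submission where

open import Defs
open import Level using (Level)
open import Algebra.Bundles using (CommutativeRing)
open import Data.List using (List; []; _∷_)
open import Data.List.Membership.Propositional using (_∈_)
open import Data.Nat using (ℕ; zero; suc)
open import Data.Product using (∃; _×_; _,_)
open import Function.Bundles using (_⇔_; mk⇔; Equivalence)
open import Function.Properties.Equivalence using () renaming (trans to ⇔-trans)
open import Relation.Binary.Core using (Rel)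
open import Relation.Binary.Definitions using (Symmetric; Transitive)

module _ {a ℓ : Level} {A : Set a} {_∼_ : Rel A ℓ}
         (∼-sym : Symmetric _∼_) (∼-trans : Transitive _∼_) where

  allRelated⇔commonClass : (xs ys : List A) → ∃ (_∈ xs) → ∃ (_∈ ys) →
    (∀ x y → x ∈ xs → y ∈ ys → x ∼ y) ⇔
    ∃ λ t → (∀ x → x ∈ xs → x ∼ t) × (∀ y → y ∈ ys → y ∼ t)
  allRelated⇔commonClass xs ys (x₀ , x₀∈xs) (y₀ , y₀∈ys) = mk⇔ common related
    where
    common : (∀ x y → x ∈ xs → y ∈ ys → x ∼ y) →
             ∃ λ t → (∀ x → x ∈ xs → x ∼ t) × (∀ y → y ∈ ys → y ∼ t)
    common rel = y₀
               , (λ x x∈xs → rel x y₀ x∈xs y₀∈ys)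
               , (λ y y∈ys → ∼-trans (∼-sym (rel x₀ y x₀∈xs y∈ys)) (rel x₀ y₀ x₀∈xs y₀∈ys))

    related : (∃ λ t → (∀ x → x ∈ xs → x ∼ t) × (∀ y → y ∈ ys → y ∼ t)) →
              ∀ x y → x ∈ xs → y ∈ ys → x ∼ y
    related (t , x∼t , y∼t) x y x∈xs y∈ys = ∼-trans (x∼t x x∈xs) (∼-sym (y∼t y y∈ys))

module _ {c ℓ : Level} (E : CommutativeRing c ℓ) where
  open CommutativeRing E hiding (zero)
  open import Algebra.Properties.Ring ring using (-0#≈0#; -‿distribˡ-*)
  open import Algebra.Properties.AbelianGroup +-abelianGroup using (⁻¹-anti-homo‿-; xyx⁻¹≈y; ⁻¹-∙-comm)
  open import Algebra.Properties.Group +-group using (//-rightDividesˡ)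
  open import Algebra.Properties.CommutativeSemigroup +-commutativeSemigroup using (interchange; xy∙z≈xz∙y)
  open import Relation.Binary.Reasoning.Setoid setoid

  private
    infix  4 _≈ₚ_
    infixl 6 _+ₚ_ _-ₚ_
    infixl 7 _*ₚ_ _·ₚ_
    infix  8 -ₚ_

    _≈ₚ_ : Poly E → Poly E → Set ℓ
    _≈ₚ_ = _≈P_ E
    _+ₚ_ _-ₚ_ _*ₚ_ : Poly E → Poly E → Poly E
    _+ₚ_ = _+P_ E
    _-ₚ_ = _-P_ E
    _*ₚ_ = _*P_ E
    _·ₚ_ : Carrier → Poly E → Poly E
    _·ₚ_ = _·P_ E
    -ₚ_ : Poly E → Poly E
    -ₚ_ = -P_ E
    [_]_ : Poly E → ℕ → Carrier
    [_]_ = coeff E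

  coeff-+P : ∀ p q n → [ p +ₚ q ] n ≈ [ p ] n + [ q ] n
  coeff-+P []      q       n       = sym (+-identityˡ _)
  coeff-+P (a ∷ p) []      n       = sym (+-identityʳ _)
  coeff-+P (a ∷ p) (b ∷ q) zero    = refl
  coeff-+P (a ∷ p) (b ∷ q) (suc n) = coeff-+P p q n

  coeff-negP : ∀ p n → [ -ₚ p ] n ≈ - [ p ] n
  coeff-negP []      n       = sym -0#≈0#
  coeff-negP (a ∷ p) zero    = refl
  coeff-negP (a ∷ p) (suc n) = coeff-negP p n

  coeff-·P : ∀ a p n → [ a ·ₚ p ] n ≈ a * [ p ] n
  coeff-·P a []      n       = sym (zeroʳ a)
  coeff-·P a (b ∷ p) zero    = refl
  coeff-·P a (b ∷ p) (suc n) = coeff-·P a p n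

  coeff-subP : ∀ p q n → [ p -ₚ q ] n ≈ [ p ] n - [ q ] n
  coeff-subP p q n = trans (coeff-+P p (-ₚ q) n) (+-congˡ (coeff-negP q n))

  coeff-∷*P : ∀ a p f n → [ (a ∷ p) *ₚ f ] n ≈ a * [ f ] n + [ 0# ∷ (p *ₚ f) ] n
  coeff-∷*P a p f n = trans (coeff-+P (a ·ₚ f) (0# ∷ (p *ₚ f)) n) (+-congʳ (coeff-·P a f n))

  negP-subP : ∀ p q → -ₚ (p -ₚ q) ≈ₚ q -ₚ p
  negP-subP p q n = begin
    [ -ₚ (p -ₚ q) ] n      ≈⟨ trans (coeff-negP (p -ₚ q) n) (-‿cong (coeff-subP p q n)) ⟩
    - ([ p ] n - [ q ] n)  ≈⟨ ⁻¹-anti-homo‿- ([ p ] n) ([ q ] n) ⟩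
    [ q ] n - [ p ] n      ≈⟨ coeff-subP q p n ⟨
    [ q -ₚ p ] n           ∎

  subP-+P-subP : ∀ p q r → (p -ₚ q) +ₚ (q -ₚ r) ≈ₚ p -ₚ r
  subP-+P-subP p q r n = begin
    [ (p -ₚ q) +ₚ (q -ₚ r) ] n             ≈⟨ coeff-+P (p -ₚ q) (q -ₚ r) n ⟩
    [ p -ₚ q ] n + [ q -ₚ r ] n            ≈⟨ +-cong (coeff-subP p q n) (coeff-subP q r n) ⟩
    ([ p ] n - [ q ] n) + ([ q ] n - [ r ] n)  ≈⟨ +-assoc ([ p ] n - [ q ] n) ([ q ] n) (- [ r ] n) ⟨
    ([ p ] n - [ q ] n) + [ q ] n - [ r ] n    ≈⟨ +-congʳ (//-rightDividesˡ ([ q ] n) ([ p ] n)) ⟩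
    [ p ] n - [ r ] n                      ≈⟨ coeff-subP p r n ⟨
    [ p -ₚ r ] n                           ∎

  *P-distribʳ-+P : ∀ f p q → (p +ₚ q) *ₚ f ≈ₚ p *ₚ f +ₚ q *ₚ f
  *P-distribʳ-+P f []      q       n = refl
  *P-distribʳ-+P f (a ∷ p) []      n = sym (trans (coeff-+P ((a ∷ p) *ₚ f) [] n) (+-identityʳ _))
  *P-distribʳ-+P f (a ∷ p) (b ∷ q) n = begin
    [ (a + b ∷ p +ₚ q) *ₚ f ] n                                 ≈⟨ coeff-∷*P (a + b) (p +ₚ q) f n ⟩
    (a + b) * [ f ] n + [ 0# ∷ (p +ₚ q) *ₚ f ] n                 ≈⟨ +-congˡ (shifted n) ⟩
    (a + b) * [ f ] n + ([ 0# ∷ p *ₚ f ] n + [ 0# ∷ q *ₚ f ] n)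
      ≈⟨ +-congʳ (distribʳ ([ f ] n) a b) ⟩
    (a * [ f ] n + b * [ f ] n) + ([ 0# ∷ p *ₚ f ] n + [ 0# ∷ q *ₚ f ] n)
      ≈⟨ interchange (a * [ f ] n) (b * [ f ] n) ([ 0# ∷ p *ₚ f ] n) ([ 0# ∷ q *ₚ f ] n) ⟩
    (a * [ f ] n + [ 0# ∷ p *ₚ f ] n) + (b * [ f ] n + [ 0# ∷ q *ₚ f ] n)
      ≈⟨ +-cong (coeff-∷*P a p f n) (coeff-∷*P b q f n) ⟨
    [ (a ∷ p) *ₚ f ] n + [ (b ∷ q) *ₚ f ] n                     ≈⟨ coeff-+P ((a ∷ p) *ₚ f) ((b ∷ q) *ₚ f) n ⟨
    [ (a ∷ p) *ₚ f +ₚ (b ∷ q) *ₚ f ] n                          ∎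
    where
    shifted : ∀ n → [ 0# ∷ (p +ₚ q) *ₚ f ] n ≈ [ 0# ∷ p *ₚ f ] n + [ 0# ∷ q *ₚ f ] n
    shifted zero    = sym (+-identityʳ 0#)
    shifted (suc m) = trans (*P-distribʳ-+P f p q m) (coeff-+P (p *ₚ f) (q *ₚ f) m)

  negP-distribˡ-*P : ∀ f p → (-ₚ p) *ₚ f ≈ₚ -ₚ (p *ₚ f)
  negP-distribˡ-*P f []      n = refl
  negP-distribˡ-*P f (a ∷ p) n = begin
    [ (- a ∷ -ₚ p) *ₚ f ] n                 ≈⟨ coeff-∷*P (- a) (-ₚ p) f n ⟩
    - a * [ f ] n + [ 0# ∷ (-ₚ p) *ₚ f ] n  ≈⟨ +-cong (-‿distribˡ-* a ([ f ] n)) (shifted n) ⟨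
    - (a * [ f ] n) + - [ 0# ∷ p *ₚ f ] n   ≈⟨ ⁻¹-∙-comm (a * [ f ] n) ([ 0# ∷ p *ₚ f ] n) ⟩
    - (a * [ f ] n + [ 0# ∷ p *ₚ f ] n)     ≈⟨ -‿cong (coeff-∷*P a p f n) ⟨
    - [ (a ∷ p) *ₚ f ] n                    ≈⟨ coeff-negP ((a ∷ p) *ₚ f) n ⟨
    [ -ₚ ((a ∷ p) *ₚ f) ] n                 ∎
    where
    shifted : ∀ n → - [ 0# ∷ p *ₚ f ] n ≈ [ 0# ∷ (-ₚ p) *ₚ f ] n
    shifted zero    = -0#≈0#
    shifted (suc m) = sym (trans (negP-distribˡ-*P f p m) (coeff-negP (p *ₚ f) m))

  module _ (f₁ f₂ : Poly E) where

    InIdeal₂-resp : ∀ {p q} → p ≈ₚ q → InIdeal₂ E f₁ f₂ p → InIdeal₂ E f₁ f₂ q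
    InIdeal₂-resp p≈q (a , b , p≈) = a , b , λ n → trans (sym (p≈q n)) (p≈ n)

    InIdeal₂-+P : ∀ {p q} → InIdeal₂ E f₁ f₂ p → InIdeal₂ E f₁ f₂ q → InIdeal₂ E f₁ f₂ (p +ₚ q)
    InIdeal₂-+P {p} {q} (a , b , p≈) (a′ , b′ , q≈) = a +ₚ a′ , b +ₚ b′ , λ n → begin
      [ p +ₚ q ] n                                              ≈⟨ coeff-+P p q n ⟩
      [ p ] n + [ q ] n
        ≈⟨ +-cong (expand p (a *ₚ f₁) (b *ₚ f₂) p≈ n) (expand q (a′ *ₚ f₁) (b′ *ₚ f₂) q≈ n) ⟩
      ([ a *ₚ f₁ ] n + [ b *ₚ f₂ ] n) + ([ a′ *ₚ f₁ ] n + [ b′ *ₚ f₂ ] n)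
        ≈⟨ interchange ([ a *ₚ f₁ ] n) ([ b *ₚ f₂ ] n) ([ a′ *ₚ f₁ ] n) ([ b′ *ₚ f₂ ] n) ⟩
      ([ a *ₚ f₁ ] n + [ a′ *ₚ f₁ ] n) + ([ b *ₚ f₂ ] n + [ b′ *ₚ f₂ ] n)
        ≈⟨ +-cong (expand ((a +ₚ a′) *ₚ f₁) (a *ₚ f₁) (a′ *ₚ f₁) (*P-distribʳ-+P f₁ a a′) n)
                 (expand ((b +ₚ b′) *ₚ f₂) (b *ₚ f₂) (b′ *ₚ f₂) (*P-distribʳ-+P f₂ b b′) n) ⟨
      [ (a +ₚ a′) *ₚ f₁ ] n + [ (b +ₚ b′) *ₚ f₂ ] n             ≈⟨ coeff-+P ((a +ₚ a′) *ₚ f₁) ((b +ₚ b′) *ₚ f₂) n ⟨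
      [ (a +ₚ a′) *ₚ f₁ +ₚ (b +ₚ b′) *ₚ f₂ ] n                  ∎
      where
      expand : ∀ r s t → r ≈ₚ s +ₚ t → ∀ n → [ r ] n ≈ [ s ] n + [ t ] n
      expand r s t r≈ n = trans (r≈ n) (coeff-+P s t n)

    InIdeal₂-negP : ∀ {p} → InIdeal₂ E f₁ f₂ p → InIdeal₂ E f₁ f₂ (-ₚ p)
    InIdeal₂-negP {p} (a , b , p≈) = -ₚ a , -ₚ b , λ n → begin
      [ -ₚ p ] n                                        ≈⟨ coeff-negP p n ⟩
      - [ p ] n                                         ≈⟨ -‿cong (trans (p≈ n) (coeff-+P (a *ₚ f₁) (b *ₚ f₂) n)) ⟩
      - ([ a *ₚ f₁ ] n + [ b *ₚ f₂ ] n)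
        ≈⟨ ⁻¹-∙-comm ([ a *ₚ f₁ ] n) ([ b *ₚ f₂ ] n) ⟨
      - [ a *ₚ f₁ ] n + - [ b *ₚ f₂ ] n                 ≈⟨ +-cong (negated a f₁ n) (negated b f₂ n) ⟨
      [ (-ₚ a) *ₚ f₁ ] n + [ (-ₚ b) *ₚ f₂ ] n           ≈⟨ coeff-+P ((-ₚ a) *ₚ f₁) ((-ₚ b) *ₚ f₂) n ⟨
      [ (-ₚ a) *ₚ f₁ +ₚ (-ₚ b) *ₚ f₂ ] n                ∎
      where
      negated : ∀ r f n → [ (-ₚ r) *ₚ f ] n ≈ - [ r *ₚ f ] n
      negated r f n = trans (negP-distribˡ-*P f r n) (coeff-negP (r *ₚ f) n)

    ∣P⇒InIdeal₂ˡ : ∀ {p} → _∣P_ E f₁ p → InIdeal₂ E f₁ f₂ p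
    ∣P⇒InIdeal₂ˡ (a , p≈) = a , [] , λ n →
      trans (p≈ n) (sym (trans (coeff-+P (a *ₚ f₁) [] n) (+-identityʳ _)))

    ∣P⇒InIdeal₂ʳ : ∀ {p} → _∣P_ E f₂ p → InIdeal₂ E f₁ f₂ p
    ∣P⇒InIdeal₂ʳ (b , p≈) = [] , b , p≈

    CongMod₂-sym : Symmetric (CongMod₂ E f₁ f₂)
    CongMod₂-sym {p} {q} p≡q =
      InIdeal₂-resp { -ₚ (p -ₚ q)} {q -ₚ p} (negP-subP p q) (InIdeal₂-negP {p -ₚ q} p≡q)

    CongMod₂-trans : Transitive (CongMod₂ E f₁ f₂)
    CongMod₂-trans {p} {q} {r} p≡q q≡r =
      InIdeal₂-resp {(p -ₚ q) +ₚ (q -ₚ r)} {p -ₚ r} (subP-+P-subP p q r)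
                    (InIdeal₂-+P {p -ₚ q} {q -ₚ r} p≡q q≡r)

    InImageψ⇔CongMod₂ : ∀ d₁ d₂ → InImageψ E f₁ f₂ d₁ d₂ ⇔ CongMod₂ E f₁ f₂ d₁ d₂
    InImageψ⇔CongMod₂ d₁ d₂ = mk⇔ image⇒congruent congruent⇒image
      where
      image⇒congruent : InImageψ E f₁ f₂ d₁ d₂ → CongMod₂ E f₁ f₂ d₁ d₂
      image⇒congruent (a , a≡d₁ , a≡d₂) = CongMod₂-trans {d₁} {a} {d₂}
        (CongMod₂-sym {a} {d₁} (∣P⇒InIdeal₂ˡ {a -ₚ d₁} a≡d₁)) (∣P⇒InIdeal₂ʳ {a -ₚ d₂} a≡d₂)

      congruent⇒image : CongMod₂ E f₁ f₂ d₁ d₂ → InImageψ E f₁ f₂ d₁ d₂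
      congruent⇒image (A , B , d₁-d₂≈) = d₁ -ₚ A *ₚ f₁ , (-ₚ A , reduces₁) , (B , reduces₂)
        where
        [A₁] [B₂] : ℕ → Carrier
        [A₁] = [ A *ₚ f₁ ]_
        [B₂] = [ B *ₚ f₂ ]_

        reduces₁ : (d₁ -ₚ A *ₚ f₁) -ₚ d₁ ≈ₚ (-ₚ A) *ₚ f₁
        reduces₁ n = begin
          [ (d₁ -ₚ A *ₚ f₁) -ₚ d₁ ] n
            ≈⟨ trans (coeff-subP (d₁ -ₚ A *ₚ f₁) d₁ n) (+-congʳ (coeff-subP d₁ (A *ₚ f₁) n)) ⟩
          ([ d₁ ] n - [A₁] n) - [ d₁ ] n ≈⟨ xyx⁻¹≈y ([ d₁ ] n) (- [A₁] n) ⟩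
          - [A₁] n                      ≈⟨ coeff-negP (A *ₚ f₁) n ⟨
          [ -ₚ (A *ₚ f₁) ] n            ≈⟨ negP-distribˡ-*P f₁ A n ⟨
          [ (-ₚ A) *ₚ f₁ ] n            ∎

        reduces₂ : (d₁ -ₚ A *ₚ f₁) -ₚ d₂ ≈ₚ B *ₚ f₂
        reduces₂ n = begin
          [ (d₁ -ₚ A *ₚ f₁) -ₚ d₂ ] n
            ≈⟨ trans (coeff-subP (d₁ -ₚ A *ₚ f₁) d₂ n) (+-congʳ (coeff-subP d₁ (A *ₚ f₁) n)) ⟩
          ([ d₁ ] n - [A₁] n) - [ d₂ ] n
            ≈⟨ xy∙z≈xz∙y ([ d₁ ] n) (- [A₁] n) (- [ d₂ ] n) ⟩
          ([ d₁ ] n - [ d₂ ] n) - [A₁] n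
            ≈⟨ +-congʳ (trans (sym (coeff-subP d₁ d₂ n)) (trans (d₁-d₂≈ n) (coeff-+P (A *ₚ f₁) (B *ₚ f₂) n))) ⟩
          ([A₁] n + [B₂] n) - [A₁] n     ≈⟨ xyx⁻¹≈y ([A₁] n) ([B₂] n) ⟩
          [B₂] n                         ∎

    Cond-i⇔allCongMod₂ : ∀ N₁ N₂ →
      Cond-i E f₁ f₂ N₁ N₂ ⇔ (∀ d₁ d₂ → d₁ ∈ N₁ → d₂ ∈ N₂ → CongMod₂ E f₁ f₂ d₁ d₂)
    Cond-i⇔allCongMod₂ N₁ N₂ = mk⇔
      (λ i d₁ d₂ d₁∈ d₂∈ → Equivalence.to (InImageψ⇔CongMod₂ d₁ d₂) (i d₁ d₂ d₁∈ d₂∈))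
      (λ i d₁ d₂ d₁∈ d₂∈ → Equivalence.from (InImageψ⇔CongMod₂ d₁ d₂) (i d₁ d₂ d₁∈ d₂∈))

digits-nonempty : ∀ {c ℓ} {E : CommutativeRing c ℓ} {f : Poly E} {D : List (Poly E)} →
                  IsIrredundantDigitSystemX E f D → ∃ (_∈ D)
digits-nonempty D-digits with IsIrredundantDigitSystemX.meetsCosets D-digits []
... | d , d∈D , _ = d , d∈D

lemma3p5 : ∀ {c ℓ : Level} (E : CommutativeRing c ℓ) → IsPID E →
    (f₁ f₂ : Poly E) → GcdOne E f₁ f₂ → FiniteQuot₂ E f₁ f₂ →
    (N₁ N₂ : List (Poly E)) →
    IsIrredundantDigitSystemX E f₁ N₁ → IsIrredundantDigitSystemX E f₂ N₂ →
    Cond-i E f₁ f₂ N₁ N₂ ⇔ Cond-ii E f₁ f₂ N₁ N₂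
lemma3p5 E _ f₁ f₂ _ _ N₁ N₂ N₁-digits N₂-digits = ⇔-trans
  (Cond-i⇔allCongMod₂ E f₁ f₂ N₁ N₂)
  (allRelated⇔commonClass (λ {p q} → CongMod₂-sym E f₁ f₂ {p} {q})
                          (λ {p q r} → CongMod₂-trans E f₁ f₂ {p} {q} {r}) N₁ N₂
                          (digits-nonempty N₁-digits) (digits-nonempty N₂-digits))
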